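{- Let $r\ge 2$ and let $n_r\ge n_{r-1}\ge\cdots\ge n_1$ be positive integers. (i) If $n_1\ge 3$, then $ar_r(\mathcal{K}_{n_1,\ldots,n_r},M_2)=1$. (ii) If $n_1=2$, let $t$ be the largest integer such that $n_t=n_1=2$. Then $ar_r(\mathcal{K}_{n_1,\ldots,n_r},M_2)=2^{t-1}$.
   Context: For disjoint vertex sets $V_1,\ldots,V_r$ with $|V_i|=n_i$, the complete $r$-partite $r$-uniform hypergraph $\mathcal{K}_{n_1,\ldots,n_r}$ has vertex set $V_1\cup\cdots\cup V_r$ and edge set all $r$-element sets $S$ with $|S\cap V_i|=1$ for every $i$. $M_2$ denotes a 2-matching (two disjoint edges). An edge-colored hypergraph is rainbow if all its edges have distinct colors. $ar_r(\mathcal{G},\mathcal{H})$ denotes the maximum number of colors in an edge-coloring of $\mathcal{G}$ containing no rainbow copy of $\mathcal{H}$. -}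

module Defs where

open import Data.Nat using (ℕ; _≤_)
open import Data.Fin using (Fin)
open import Data.Product using (Σ; ∃; _×_)
open import Relation.Binary.PropositionalEquality using (_≡_; _≢_)

-- Complete r-partite r-uniform hypergraph K_{n_1,...,n_r}:
-- part i (i : Fin r) has vertex set Fin (n i); an edge picks exactly one
-- vertex from each part, i.e. is a choice function.
Edge : {r : ℕ} → (Fin r → ℕ) → Set
Edge {r} n = (i : Fin r) → Fin (n i)

Disjoint : {r : ℕ} {n : Fin r → ℕ} → Edge n → Edge n → Set
Disjoint {r} e f = (i : Fin r) → e i ≢ f i

Surj : {A : Set} {m : ℕ} → (A → Fin m) → Set
Surj {A} {m} c = (y : Fin m) → Σ A (λ x → c x ≡ y)

NoRainbowM2 : {r : ℕ} {n : Fin r → ℕ} {m : ℕ} → (Edge n → Fin m) → Set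
NoRainbowM2 {n = n} c = (e f : Edge n) → Disjoint e f → c e ≡ c f

IsAR-M2 : {r : ℕ} → (Fin r → ℕ) → ℕ → Set
IsAR-M2 n k =
  Σ (Edge n → Fin k) (λ c → Surj c × NoRainbowM2 c)
  × ((m : ℕ) (c : Edge n → Fin m) → Surj c → NoRainbowM2 c → m ≤ k)

-- Only the parts of size 2 constrain a colouring without rainbow M₂. Two
-- edges e, f are joined by a common disjoint edge exactly when they agree on
-- every part of size 2 (a part of size ≥ 3 always has a vertex avoiding both),
-- so such a colouring is constant on edges that agree on the pairs; since e and
-- its antipode (the other vertex on every pair) are disjoint, it is also
-- constant on edges that disagree on every pair. With p parts of size 2 this
-- leaves 2^p / 2 classes, and colouring by class has no rainbow M₂ because
-- disjoint edges disagree on every pair.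
module Submission where

open import Defs
open import Data.Nat using (ℕ; suc; _≤_; _^_; z≤n; s≤s; s≤s⁻¹; _≤?_)
open import Data.Nat.Properties using (≤-trans; ≤-antisym; ≤-reflexive; ≤∧≢⇒<; ≰⇒>; n≤1+n)
open import Data.Fin using (Fin; zero; suc; toℕ; inject≤; fromℕ<; combine; funToFin; finToFun)
  renaming (_<_ to _<ᶠ_; _≤_ to _≤ᶠ_)
open import Data.Fin.Properties
  using (toℕ-injective; toℕ<n; toℕ≤pred[n]; toℕ-inject≤; toℕ-fromℕ<; injective⇒≤;
         2↔Bool; funToFin-finToFin; finToFun-funToFin)
open import Data.Bool using (Bool; true; false; not; _xor_)
open import Data.Bool.Properties using (not-involutive; not-injective; not-¬; xor-identityʳ)
open import Data.Vec.Functional using (_∷_)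
open import Data.Product using (∃; _×_; _,_; proj₁; proj₂)
open import Data.Empty using (⊥-elim)
open import Function using (_∘_)
open import Function.Bundles using (Inverse)
open import Relation.Nullary using (yes; no)
open import Relation.Binary.PropositionalEquality
  using (_≡_; _≢_; _≗_; refl; sym; trans; cong; cong₂; subst; module ≡-Reasoning)

open Inverse 2↔Bool using (to; from; strictlyInverseˡ; strictlyInverseʳ)

xor-inverse-cancel : ∀ a b → (a xor b) xor a ≡ b
xor-inverse-cancel false b = xor-identityʳ b
xor-inverse-cancel true false = refl
xor-inverse-cancel true true = refl

xor-solve : ∀ a b x y → a xor x ≡ b xor y → y ≡ (a xor b) xor x
xor-solve false false x y eq = sym eq
xor-solve true true x y eq = sym (not-injective eq)
xor-solve true false x y eq = sym eq
xor-solve false true x y eq = trans (sym (not-involutive y)) (cong not (sym eq))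

xor-shift-cancel : ∀ δ a b → (δ xor a) xor (δ xor b) ≡ a xor b
xor-shift-cancel false a b = refl
xor-shift-cancel true false b = not-involutive b
xor-shift-cancel true true b = refl

funToFin-cong : ∀ {m n} {f g : Fin m → Fin n} → f ≗ g → funToFin f ≡ funToFin g
funToFin-cong {ℕ.zero} _ = refl
funToFin-cong {suc m} f≗g = cong₂ combine (f≗g zero) (funToFin-cong (f≗g ∘ suc))

code : ∀ {T} → (Fin T → Bool) → Fin (2 ^ T)
code s = funToFin (from ∘ s)

code-cong : ∀ {T} {s s′ : Fin T → Bool} → s ≗ s′ → code s ≡ code s′
code-cong s≗s′ = funToFin-cong (cong from ∘ s≗s′)

code-injective : ∀ {T} {s s′ : Fin T → Bool} → code s ≡ code s′ → s ≗ s′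
code-injective {s = s} {s′} eq j = begin
  s j                        ≡⟨ strictlyInverseˡ (s j) ⟨
  to (from (s j))            ≡⟨ cong to (finToFun-funToFin (from ∘ s) j) ⟨
  to (finToFun (code s) j)   ≡⟨ cong (λ y → to (finToFun y j)) eq ⟩
  to (finToFun (code s′) j)  ≡⟨ cong to (finToFun-funToFin (from ∘ s′) j) ⟩
  to (from (s′ j))           ≡⟨ strictlyInverseˡ (s′ j) ⟩
  s′ j                       ∎
  where open ≡-Reasoning

code-surjective : ∀ {T} (y : Fin (2 ^ T)) → ∃ λ (s : Fin T → Bool) → code s ≡ y
code-surjective {T} y =
  to ∘ finToFun y ,
  trans (funToFin-cong {T} (strictlyInverseʳ ∘ finToFun y)) (funToFin-finToFin {T} y)

padWith : ∀ {A : Set} {m n} → A → (Fin m → A) → Fin n → A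
padWith {m = ℕ.zero} a f _ = a
padWith {m = suc m} a f zero = f zero
padWith {m = suc m} a f (suc i) = padWith a (f ∘ suc) i

padWith-inject≤ : ∀ {A : Set} {m n} (a : A) (f : Fin m → A) (j : Fin m) .(m≤n : m ≤ n)
  → padWith a f (inject≤ j m≤n) ≡ f j
padWith-inject≤ {n = suc n} a f zero _ = refl
padWith-inject≤ {n = suc n} a f (suc j) m≤n = padWith-inject≤ a (f ∘ suc) j (s≤s⁻¹ m≤n)

bit : ∀ {N} → Fin N → Bool
bit zero = true
bit (suc _) = false

vertex : ∀ {N} → 2 ≤ N → Bool → Fin N
vertex (s≤s (s≤s _)) true = zero
vertex (s≤s (s≤s _)) false = suc zero

bit-vertex : ∀ {N} (2≤N : 2 ≤ N) b → bit (vertex 2≤N b) ≡ b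
bit-vertex (s≤s (s≤s _)) true = refl
bit-vertex (s≤s (s≤s _)) false = refl

other : ∀ {N} → 2 ≤ N → Fin N → Fin N
other 2≤N a = vertex 2≤N (not (bit a))

bit-other : ∀ {N} (2≤N : 2 ≤ N) a → bit (other 2≤N a) ≡ not (bit a)
bit-other 2≤N a = bit-vertex 2≤N (not (bit a))

other-≢ : ∀ {N} (2≤N : 2 ≤ N) a → other 2≤N a ≢ a
other-≢ 2≤N a eq = not-¬ refl (sym (trans (sym (bit-other 2≤N a)) (cong bit eq)))

bit-injective : ∀ {N} → N ≡ 2 → {a b : Fin N} → bit a ≡ bit b → a ≡ b
bit-injective refl {zero} {zero} _ = refl
bit-injective refl {suc zero} {suc zero} _ = refl

bit-≢ : ∀ {N} → N ≡ 2 → {a b : Fin N} → a ≢ b → bit b ≡ not (bit a)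
bit-≢ refl {zero} {zero} a≢b = ⊥-elim (a≢b refl)
bit-≢ refl {zero} {suc zero} _ = refl
bit-≢ refl {suc zero} {zero} _ = refl
bit-≢ refl {suc zero} {suc zero} a≢b = ⊥-elim (a≢b refl)

avoid-two : ∀ {N} → 3 ≤ N → (a b : Fin N) → ∃ λ v → v ≢ a × v ≢ b
avoid-two (s≤s (s≤s (s≤s _))) (suc a) (suc b) = zero , (λ ()) , (λ ())
avoid-two (s≤s (s≤s (s≤s _))) zero zero = suc zero , (λ ()) , (λ ())
avoid-two (s≤s (s≤s (s≤s _))) zero (suc (suc b)) = suc zero , (λ ()) , (λ ())
avoid-two (s≤s (s≤s (s≤s _))) (suc (suc a)) zero = suc zero , (λ ()) , (λ ())
avoid-two (s≤s (s≤s (s≤s _))) zero (suc zero) = suc (suc zero) , (λ ()) , (λ ())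
avoid-two (s≤s (s≤s (s≤s _))) (suc zero) zero = suc (suc zero) , (λ ()) , (λ ())

Surj-factor⇒≤ : ∀ {A : Set} {m K} (c : A → Fin m) → Surj c → (h : A → Fin K)
  → (∀ x y → h x ≡ h y → c x ≡ c y) → m ≤ K
Surj-factor⇒≤ c surj h factor = injective⇒≤ {f = h ∘ proj₁ ∘ surj} λ {y} {y′} eq →
  trans (sym (proj₂ (surj y))) (trans (factor _ _ eq) (proj₂ (surj y′)))

universal⇒IsAR-M2 : ∀ {r} {n : Fin r → ℕ} {K} (h : Edge n → Fin K) → Surj h → NoRainbowM2 h
  → (∀ {m} (c : Edge n → Fin m) → NoRainbowM2 c → ∀ e f → h e ≡ h f → c e ≡ c f)
  → IsAR-M2 n K
universal⇒IsAR-M2 h surj noRainbow universal =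
  (h , surj , noRainbow) , λ m c surjc noRainbowc → Surj-factor⇒≤ c surjc h (universal c noRainbowc)

module _ {r} {n : Fin r → ℕ} {m} {c : Edge n → Fin m} (noRainbow : NoRainbowM2 c) where

  commonDisjoint⇒sameColour : ∀ {e f} → (∀ i → ∃ λ v → v ≢ e i × v ≢ f i) → c e ≡ c f
  commonDisjoint⇒sameColour {e} {f} avoid =
    trans (noRainbow e g (λ i eq → proj₁ (proj₂ (avoid i)) (sym eq))) (noRainbow g f (proj₂ ∘ proj₂ ∘ avoid))
    where
    g : Edge n
    g = proj₁ ∘ avoid

  allLarge⇒constant : (∀ i → 3 ≤ n i) → ∀ e f → c e ≡ c f
  allLarge⇒constant large e f = commonDisjoint⇒sameColour (λ i → avoid-two (large i) (e i) (f i))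

allLarge⇒IsAR-M2 : ∀ {r} {n : Fin r → ℕ} → (∀ i → 3 ≤ n i) → IsAR-M2 n 1
allLarge⇒IsAR-M2 {n = n} large = universal⇒IsAR-M2 (λ _ → zero) surj (λ _ _ _ → refl)
  (λ c noRainbow e f _ → allLarge⇒constant noRainbow large e f)
  where
  surj : Surj {Edge n} (λ _ → zero)
  surj zero = (λ i → vertex (≤-trans (n≤1+n 2) (large i)) true) , refl
  surj (suc ())

module PairPrefix {k} (n : Fin (suc k) → ℕ) (t : Fin (suc k))
  (pair : ∀ i → i ≤ᶠ t → n i ≡ 2) (large : ∀ i → t <ᶠ i → 3 ≤ n i) where

  T : ℕ
  T = toℕ t

  atLeastTwo : ∀ i → 2 ≤ n i
  atLeastTwo i with toℕ i ≤? T
  ... | yes i≤t = ≤-reflexive (sym (pair i i≤t))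
  ... | no i≰t = ≤-trans (n≤1+n 2) (large i (≰⇒> i≰t))

  part : Fin (suc T) → Fin (suc k)
  part j = inject≤ j (toℕ<n t)

  part-≤ : ∀ j → part j ≤ᶠ t
  part-≤ j = ≤-trans (≤-reflexive (toℕ-inject≤ j (toℕ<n t))) (toℕ≤pred[n] j)

  part-onto : ∀ i → i ≤ᶠ t → ∃ λ j → part j ≡ i
  part-onto i i≤t =
    fromℕ< (s≤s i≤t) , toℕ-injective (trans (toℕ-inject≤ _ (toℕ<n t)) (toℕ-fromℕ< (s≤s i≤t)))

  Shifted : Bool → Edge n → Edge n → Set
  Shifted δ e f = ∀ i → i ≤ᶠ t → bit (f i) ≡ δ xor bit (e i)

  antipode : Edge n → Edge n
  antipode e i = other (atLeastTwo i) (e i)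

  antipode-disjoint : ∀ e → Disjoint e (antipode e)
  antipode-disjoint e i eq = other-≢ (atLeastTwo i) (e i) (sym eq)

  disjoint⇒shifted : ∀ {e f} → Disjoint e f → Shifted true e f
  disjoint⇒shifted disjoint i i≤t = bit-≢ (pair i i≤t) (disjoint i)

  -- Read relative to part 0, so that flipping every pair leaves it unchanged.
  signature : Edge n → Fin T → Bool
  signature e j = bit (e zero) xor bit (e (part (suc j)))

  shifted⇒signature : ∀ {δ e f} → Shifted δ e f → signature e ≗ signature f
  shifted⇒signature {δ} {e} shifted j = sym (trans
    (cong₂ _xor_ (shifted zero z≤n) (shifted (part (suc j)) (part-≤ (suc j))))
    (xor-shift-cancel δ (bit (e zero)) (bit (e (part (suc j))))))

  signature⇒shifted : ∀ {e f} → signature e ≗ signature f → Shifted (bit (e zero) xor bit (f zero)) e f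
  signature⇒shifted {e} {f} sig i i≤t with part-onto i i≤t
  ... | j , refl = at-part j
    where
    at-part : ∀ j → bit (f (part j)) ≡ (bit (e zero) xor bit (f zero)) xor bit (e (part j))
    at-part zero = sym (xor-inverse-cancel (bit (e zero)) (bit (f zero)))
    at-part (suc j) = xor-solve (bit (e zero)) (bit (f zero)) _ _ (sig j)

  module _ {m} {c : Edge n → Fin m} (noRainbow : NoRainbowM2 c) where

    agreeOnPairs⇒sameColour : ∀ {e f} → Shifted false e f → c e ≡ c f
    agreeOnPairs⇒sameColour {e} {f} agree = commonDisjoint⇒sameColour noRainbow avoid
      where
      avoid : ∀ i → ∃ λ v → v ≢ e i × v ≢ f i
      avoid i with toℕ i ≤? T
      ... | no i≰t = avoid-two (large i (≰⇒> i≰t)) (e i) (f i)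
      ... | yes i≤t = other (atLeastTwo i) (e i) , other-≢ (atLeastTwo i) (e i) ,
        subst (other (atLeastTwo i) (e i) ≢_) (bit-injective (pair i i≤t) (sym (agree i i≤t)))
          (other-≢ (atLeastTwo i) (e i))

    shifted⇒sameColour : ∀ {δ e f} → Shifted δ e f → c e ≡ c f
    shifted⇒sameColour {false} = agreeOnPairs⇒sameColour
    shifted⇒sameColour {true} {e} {f} shifted =
      trans (noRainbow e (antipode e) (antipode-disjoint e))
            (agreeOnPairs⇒sameColour λ i i≤t → trans (shifted i i≤t) (sym (bit-other (atLeastTwo i) (e i))))

  colour : Edge n → Fin (2 ^ T)
  colour e = code (signature e)

  colour-noRainbow : NoRainbowM2 colour
  colour-noRainbow e f disjoint = code-cong (shifted⇒signature {true} {e} {f} (disjoint⇒shifted disjoint))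

  colour-surjective : Surj colour
  colour-surjective y with code-surjective y
  ... | s , code-s≡y = E , trans (code-cong signature-E) code-s≡y
    where
    E : Edge n
    E i = vertex (atLeastTwo i) (padWith false (false ∷ s) i)
    bit-E : ∀ j → bit (E (part j)) ≡ (false ∷ s) j
    bit-E j = trans (bit-vertex (atLeastTwo (part j)) _) (padWith-inject≤ false (false ∷ s) j (toℕ<n t))
    signature-E : signature E ≗ s
    signature-E j = cong₂ _xor_ (bit-E zero) (bit-E (suc j))

  colour-universal : ∀ {m} (c : Edge n → Fin m) → NoRainbowM2 c → ∀ e f → colour e ≡ colour f → c e ≡ c f
  colour-universal c noRainbow e f eq =
    shifted⇒sameColour noRainbow {bit (e zero) xor bit (f zero)} (signature⇒shifted {e} {f} (code-injective eq))

  isAR-M2 : IsAR-M2 n (2 ^ T)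
  isAR-M2 = universal⇒IsAR-M2 colour colour-surjective colour-noRainbow colour-universal

theorem1p7 : (k : ℕ) → 1 ≤ k → (n : Fin (suc k) → ℕ)
    → (∀ i j → i ≤ᶠ j → n i ≤ n j) → 1 ≤ n zero
    → (3 ≤ n zero → IsAR-M2 n 1)
    × (n zero ≡ 2 → (t : Fin (suc k)) → n t ≡ 2 → (∀ j → t <ᶠ j → n j ≢ 2)
    → IsAR-M2 n (2 ^ toℕ t))
theorem1p7 k _ n mono _ = partI , partII
  where
  partI : 3 ≤ n zero → IsAR-M2 n 1
  partI 3≤n₀ = allLarge⇒IsAR-M2 λ i → ≤-trans 3≤n₀ (mono zero i z≤n)
  partII : n zero ≡ 2 → (t : Fin (suc k)) → n t ≡ 2 → (∀ j → t <ᶠ j → n j ≢ 2)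
    → IsAR-M2 n (2 ^ toℕ t)
  partII n₀≡2 t nₜ≡2 above = PairPrefix.isAR-M2 n t pair large
    where
    2≤n : ∀ i → 2 ≤ n i
    2≤n i = subst (_≤ n i) n₀≡2 (mono zero i z≤n)
    pair : ∀ i → i ≤ᶠ t → n i ≡ 2
    pair i i≤t = ≤-antisym (subst (n i ≤_) nₜ≡2 (mono i t i≤t)) (2≤n i)
    large : ∀ i → t <ᶠ i → 3 ≤ n i
    large i t<i = ≤∧≢⇒< (2≤n i) (λ 2≡nᵢ → above i t<i (sym 2≡nᵢ))
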